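{- Let $(A,\mathrm{Con},\vdash,\Delta)$ and $(A',\mathrm{Con}',\vdash',\Delta')$ be information systems with witnesses and $H\subseteq\mathrm{Con}\times A'$. Then the following are equivalent: (I) $H$ satisfies, for all $(i,X)\in\mathrm{Con}$, $b\in A'$ and finite $F\subseteq A'$: (M6) $(i,X)Hb\Rightarrow\exists(d,V)\in\mathrm{Con}'\,[(i,X)H(d,V)\wedge(d,V)\vdash' b]$, and (M7) $(i,X)HF\Rightarrow\exists e\in A'\,[(i,X)He\wedge F\in\mathrm{Con}'(e)]$; (II) for all $(i,X)\in\mathrm{Con}$ and all finite $F\subseteq A'$: if $(i,X)HF$ then there is $(e,V)\in\mathrm{Con}'$ with $(i,X)H(e,V)$ and $(e,V)\vdash' F$.
   Context: An information system with witnesses is a tuple $(A,\mathrm{Con},\vdash,\Delta)$ where $A$ is a set, $\Delta\in A$, $\mathrm{Con}\subseteq A\times\mathcal{P}_f(A)$ and ${\vdash}\subseteq \mathrm{Con}\times A$. Write $X\in\mathrm{Con}(i)$ for $(i,X)\in\mathrm{Con}$; $(i,X)\vdash Y$ means $(i,X)\vdash c$ for all $c\in Y$. Required for all $i,j,a\in A$ and finite $X,Y\subseteq A$: (1) $\{i\}\in\mathrm{Con}(i)$; (2) $Y\subseteq X\wedge X\in\mathrm{Con}(i)\Rightarrow Y\in\mathrm{Con}(i)$; (3) $(i,\emptyset)\vdash\Delta$; (4) $X\in\mathrm{Con}(i)\wedge(i,X)\vdash Y\Rightarrow Y\in\mathrm{Con}(i)$; (5) $X,Y\in\mathrm{Con}(i)\wedge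 X\subseteq Y\wedge(i,X)\vdash a\Rightarrow(i,Y)\vdash a$; (6) $X\in\mathrm{Con}(i)\wedge(i,X)\vdash Y\wedge(i,Y)\vdash a\Rightarrow(i,X)\vdash a$; (7) $(i,X)\vdash a\Rightarrow\exists Z\in\mathrm{Con}(i)\,[(i,X)\vdash Z\wedge(i,Z)\vdash a]$; (8) $(i,X)\vdash Y\Rightarrow\exists e\in A\,[(i,X)\vdash e\wedge Y\in\mathrm{Con}(e)]$; (9) $\{i\}\in\mathrm{Con}(j)\Rightarrow\mathrm{Con}(i)\subseteq\mathrm{Con}(j)$; (10) $\{i\}\in\mathrm{Con}(j)\wedge X\in\mathrm{Con}(i)\wedge(i,X)\vdash a\Rightarrow(j,X)\vdash a$; (11) $\{i\}\in\mathrm{Con}(j)\wedge X\in\mathrm{Con}(i)\wedge(j,X)\vdash a\Rightarrow(i,X)\vdash a$. For $H\subseteq\mathrm{Con}\times A'$ write $(i,X)Hb$ for $((i,X),b)\in H$, $(i,X)HF$ if $(i,X)Hc$ for all $c\in F$, and $(i,X)H(e,V)$ if $(i,X)He$ and $(i,X)HV$. -}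

module Defs where

open import Data.List using (List; []; _∷_; [_])
open import Data.List.Membership.Propositional using (_∈_)
open import Data.List.Relation.Binary.Subset.Propositional using (_⊆_)
open import Data.List.Relation.Unary.All using (All)
open import Data.Product using (Σ; ∃; _×_; _,_)

-- Finite subsets of A are represented by lists (membership-based subset _⊆_).
-- Con i X  means  X ∈ Con(i);   Ent i X a  means  (i,X) ⊢ a.
record InfoSysW : Set₁ where
  field
    A   : Set
    Con : A → List A → Set
    Ent : A → List A → A → Set
    Δ   : A

  EntS : A → List A → List A → Set
  EntS i X Y = All (Ent i X) Y

  field
    ax1  : ∀ i → Con i [ i ]
    ax2  : ∀ {i X Y} → Y ⊆ X → Con i X → Con i Y
    ax3  : ∀ i → Ent i [] Δ
    ax4  : ∀ {i X Y} → Con i X → EntS i X Y → Con i Y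
    ax5  : ∀ {i X Y a} → Con i X → Con i Y → X ⊆ Y → Ent i X a → Ent i Y a
    ax6  : ∀ {i X Y a} → Con i X → EntS i X Y → Ent i Y a → Ent i X a
    ax7  : ∀ {i X a} → Ent i X a → Σ (List A) λ Z → Con i Z × EntS i X Z × Ent i Z a
    ax8  : ∀ {i X Y} → EntS i X Y → Σ A λ e → Ent i X e × Con e Y
    ax9  : ∀ {i j} → Con j [ i ] → ∀ {X} → Con i X → Con j X
    ax10 : ∀ {i j X a} → Con j [ i ] → Con i X → Ent i X a → Ent j X a
    ax11 : ∀ {i j X a} → Con j [ i ] → Con i X → Ent j X a → Ent i X a

-- A relation H ⊆ Con × A' is given as a predicate on (i, X, b); only its
-- values at pairs (i,X) with X ∈ Con(i) are ever used.
module _ (S S' : InfoSysW) where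
  open InfoSysW S
  open InfoSysW S' renaming (A to A'; Con to Con'; Ent to Ent'; EntS to EntS')

  HS : (A → List A → A' → Set) → A → List A → List A' → Set
  HS H i X F = All (H i X) F

  M6 : (A → List A → A' → Set) → Set
  M6 H = ∀ i X b → Con i X → H i X b →
         Σ A' λ d → Σ (List A') λ V → Con' d V × H i X d × HS H i X V × Ent' d V b

  M7 : (A → List A → A' → Set) → Set
  M7 H = ∀ i X (F : List A') → Con i X → HS H i X F →
         Σ A' λ e → H i X e × Con' e F

  CondII : (A → List A → A' → Set) → Set
  CondII H = ∀ i X (F : List A') → Con i X → HS H i X F →
             Σ A' λ e → Σ (List A') λ V → Con' e V × H i X e × HS H i X V × EntS' e V F

module Submission where

open import Defs
open import Data.Product using (Σ; _×_; _,_)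
open import Function.Bundles using (_⇔_; mk⇔)
open import Data.List using (List; []; _∷_; [_]; _++_)
open import Data.List.Membership.Propositional using (_∈_)
open import Data.List.Membership.Propositional.Properties using (∈-++⁺ˡ; ∈-++⁺ʳ)
open import Data.List.Relation.Binary.Subset.Propositional using (_⊆_)
open import Data.List.Relation.Unary.All as All using (All; []; _∷_)
open import Data.List.Relation.Unary.All.Properties using (++⁺)
open import Data.List.Relation.Unary.Any using (here; there)
open import Relation.Binary.PropositionalEquality using (refl)

-- Forward direction: by (M6) every c ∈ F is entailed by some (d_c, V_c) in H;
-- by (M7) the union W of all {d_c} ∪ V_c is consistent at a single e in H, and
-- the transfer axiom (10) moves each entailment (d_c, V_c) ⊢' c to (e, W) ⊢' c.
-- Conversely (M6) is (II) for F = {b}, and (M7) follows from (II) by axiom (4).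

gather-monotone : {A B : Set} {R : B → Set} {P : List B → A → Set} →
  (∀ {W W'} → W ⊆ W' → ∀ {a} → P W a → P W' a) →
  ∀ {F} → All (λ a → Σ (List B) λ W → All R W × P W a) F →
  Σ (List B) λ W → All R W × All (P W) F
gather-monotone mono []                       = [] , [] , []
gather-monotone mono ((W , rW , pW) ∷ rest) with gather-monotone mono rest
... | W' , rW' , pW' = W ++ W' , ++⁺ rW rW' , mono ∈-++⁺ˡ pW ∷ All.map (mono (∈-++⁺ʳ W)) pW'

module _ (S : InfoSysW) where
  open InfoSysW S

  EntailedWithin : List A → A → Set
  EntailedWithin W c = Σ A λ d → Σ (List A) λ V → d ∈ W × V ⊆ W × Con d V × Ent d V c

  EntailedWithin-mono : ∀ {W W'} → W ⊆ W' → ∀ {c} → EntailedWithin W c → EntailedWithin W' c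
  EntailedWithin-mono W⊆W' (d , V , d∈W , V⊆W , conV , ent) =
    d , V , W⊆W' d∈W , (λ x∈V → W⊆W' (V⊆W x∈V)) , conV , ent

  EntailedWithin-witness : ∀ {d V c} → Con d V → Ent d V c → EntailedWithin (d ∷ V) c
  EntailedWithin-witness conV ent = _ , _ , here refl , there , conV , ent

  Con⇒EntailedWithin⇒Ent : ∀ {e W c} → Con e W → EntailedWithin W c → Ent e W c
  Con⇒EntailedWithin⇒Ent conW (d , V , d∈W , V⊆W , conV , ent) =
    ax5 conV' conW V⊆W (ax10 conD conV ent)
    where
    conD = ax2 (λ { (here refl) → d∈W }) conW
    conV' = ax2 V⊆W conW

module _ (S S' : InfoSysW) (H : InfoSysW.A S → List (InfoSysW.A S) → InfoSysW.A S' → Set) where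
  open InfoSysW S' using () renaming (ax4 to ax4')

  M6×M7⇒CondII : M6 S S' H × M7 S S' H → CondII S S' H
  M6×M7⇒CondII (m6 , m7) i X F conX hF
    with gather-monotone (EntailedWithin-mono S') (All.map witnessFor hF)
    where
    witnessFor : ∀ {c} → H i X c → Σ _ λ W → HS S S' H i X W × EntailedWithin S' W c
    witnessFor hc with m6 i X _ conX hc
    ... | d , V , conV , hd , hV , ent = d ∷ V , hd ∷ hV , EntailedWithin-witness S' conV ent
  ... | W , hW , entW with m7 i X W conX hW
  ... | e , he , conW = e , W , conW , he , hW , All.map (Con⇒EntailedWithin⇒Ent S' conW) entW

  CondII⇒M6 : CondII S S' H → M6 S S' H
  CondII⇒M6 condII i X b conX hb with condII i X [ b ] conX (hb ∷ [])
  ... | e , V , conV , he , hV , ent ∷ [] = e , V , conV , he , hV , ent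

  CondII⇒M7 : CondII S S' H → M7 S S' H
  CondII⇒M7 condII i X F conX hF with condII i X F conX hF
  ... | e , V , conV , he , hV , ents = e , he , ax4' conV ents

lemma4p3 : (S S' : InfoSysW) (H : InfoSysW.A S → List (InfoSysW.A S) → InfoSysW.A S' → Set) →
    (M6 S S' H × M7 S S' H) ⇔ CondII S S' H
lemma4p3 S S' H =
  mk⇔ (M6×M7⇒CondII S S' H) (λ condII → CondII⇒M6 S S' H condII , CondII⇒M7 S S' H condII)
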